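{- Let $p$ be a prime with $p \equiv 7$ or $23 \pmod{40}$. Then there is no triple $(N,M,e) \in \mathbb{Z}^3$ with $M \neq 0$, $e \neq 0$ satisfying $N^2 = pM^4 - 5e^4$ together with $\gcd(N,e)=\gcd(M,e)=\gcd(p,e)=\gcd(5,M)=\gcd(M,N)=1$. -}

module Defs where

-- Reduce modulo 5. Since 5 ∤ M, Fermat gives M⁴ ≡ 1, so the equation forces N² ≡ p (mod 5).
-- But p ≡ 7 or 23 (mod 40) means p ≡ 2 or 3 (mod 5), and neither is a square modulo 5.
-- Only gcd(5, M) = 1 and p mod 40 are used; primality and the other coprimality conditions are not.
module Submission where

open import Defs
open import Data.Nat using (ℕ; _%_)
open import Data.Nat.Primality using (Prime)
open import Data.Integer using (ℤ; +_; _+_; _-_; _*_; _^_; 1ℤ; 0ℤ)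
open import Data.Integer.GCD using (gcd)
open import Data.Product using (_×_; ∃-syntax)
open import Data.Sum using (_⊎_)
open import Relation.Binary.PropositionalEquality using (_≡_; _≢_)
open import Relation.Nullary using (¬_)

open import Level using (0ℓ)
open import Data.Nat using (zero; suc; _<_; s≤s; NonZero)
import Data.Nat as ℕ
open import Data.Nat.DivMod using (%-remove-+ʳ; m∣n⇒o%n%m≡o%m)
open import Data.Nat.Divisibility using (divides; m∣m*n; ∣-refl; ∣1⇒≡1)
open import Data.Integer using (-_; -[1+_]; ∣_∣; _%ℕ_; _/ℕ_)
open import Data.Integer.Properties
  using (+-injective; +-identityˡ; *-identityʳ; *-comm; abs-*; pos-+; pos-*)
open import Data.Integer.DivMod using (n%ℕd<d; a≡a%ℕn+[a/ℕn]*n)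
open import Data.Integer.Divisibility using (_∣_)
import Data.Integer.GCD as ℤGCD
open import Data.Integer.Tactic.RingSolver using (solve-∀)
open import Data.Product using (_,_)
open import Data.Empty using (⊥-elim)
open import Data.Sum using (inj₁; inj₂)
import Data.Sum as Sum
open import Relation.Binary.Bundles using (Setoid)
open import Relation.Binary.Structures using (IsEquivalence)
open import Relation.Binary.PropositionalEquality
  using (refl; sym; trans; cong; subst; module ≡-Reasoning)
import Relation.Binary.Reasoning.Setoid as SetoidReasoning

infix 4 _≡_mod_

record _≡_mod_ (x y : ℤ) (m : ℕ) : Set where
  constructor multiple
  field
    k      : ℤ
    x≡y+mk : x ≡ y + + m * k

module _ {m : ℕ} where

  ≡-mod-refl : ∀ {x} → x ≡ x mod m
  ≡-mod-refl {x} = multiple 0ℤ (identity x (+ m))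
    where
    identity : ∀ x k → x ≡ x + k * 0ℤ
    identity = solve-∀

  ≡-mod-sym : ∀ {x y} → x ≡ y mod m → y ≡ x mod m
  ≡-mod-sym {y = y} (multiple t x≡y+mt) =
    multiple (- t) (trans (identity y t (+ m)) (cong (_+ + m * - t) (sym x≡y+mt)))
    where
    identity : ∀ y t k → y ≡ (y + k * t) + k * (- t)
    identity = solve-∀

  ≡-mod-trans : ∀ {x y z} → x ≡ y mod m → y ≡ z mod m → x ≡ z mod m
  ≡-mod-trans {z = z} (multiple t refl) (multiple u refl) =
    multiple (u + t) (identity z t u (+ m))
    where
    identity : ∀ z t u k → (z + k * u) + k * t ≡ z + k * (u + t)
    identity = solve-∀

  ≡-mod-* : ∀ {x x′ y y′} → x ≡ x′ mod m → y ≡ y′ mod m → x * y ≡ x′ * y′ mod m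
  ≡-mod-* {x′ = x′} {y′ = y′} (multiple t refl) (multiple u refl) =
    multiple (t * y′ + x′ * u + + m * t * u) (identity x′ y′ t u (+ m))
    where
    identity : ∀ x y t u k → (x + k * t) * (y + k * u) ≡ x * y + k * (t * y + x * u + k * t * u)
    identity = solve-∀

  ≡-mod-^ : ∀ {x y} n → x ≡ y mod m → x ^ n ≡ y ^ n mod m
  ≡-mod-^ zero    x≡y = ≡-mod-refl
  ≡-mod-^ (suc n)   x≡y = ≡-mod-* x≡y (≡-mod-^ n x≡y)

  x-m*y≡x : ∀ x y → x - + m * y ≡ x mod m
  x-m*y≡x x y = multiple (- y) (identity x y (+ m))
    where
    identity : ∀ x y k → x - k * y ≡ x + k * (- y)
    identity = solve-∀

  ≡-mod-isEquivalence : IsEquivalence (λ x y → x ≡ y mod m)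
  ≡-mod-isEquivalence = record { refl = ≡-mod-refl ; sym = ≡-mod-sym ; trans = ≡-mod-trans }

≡-mod-setoid : ℕ → Setoid 0ℓ 0ℓ
≡-mod-setoid m = record { isEquivalence = ≡-mod-isEquivalence {m} }

module ≡-mod-Reasoning (m : ℕ) = SetoidReasoning (≡-mod-setoid m)

module _ {m : ℕ} .{{_ : NonZero m}} where

  x≡x%ℕm : ∀ x → x ≡ + (x %ℕ m) mod m
  x≡x%ℕm x = multiple (x /ℕ m)
    (trans (a≡a%ℕn+[a/ℕn]*n x m) (cong (_+_ (+ (x %ℕ m))) (*-comm (x /ℕ m) (+ m))))

  +≡+m*+⇒%≡ : ∀ {a b k} → + a ≡ + b + + m * + k → a % m ≡ b % m
  +≡+m*+⇒%≡ {a} {b} {k} eq = trans (cong (_% m) a≡b+m*k) (%-remove-+ʳ b (m∣m*n k))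
    where
    a≡b+m*k : a ≡ b ℕ.+ m ℕ.* k
    a≡b+m*k = +-injective
      (trans eq (trans (cong (_+_ (+ b)) (sym (pos-* m k))) (sym (pos-+ b (m ℕ.* k)))))

  ≡-mod⇒%≡ : ∀ {a b} → + a ≡ + b mod m → a % m ≡ b % m
  ≡-mod⇒%≡ (multiple (+ k) a≡b) = +≡+m*+⇒%≡ a≡b
  -- For a negative multiple, symmetry yields the positive multiple - -[1+ k ] = + suc k.
  ≡-mod⇒%≡ a≡b@(multiple -[1+ k ] _) = sym (+≡+m*+⇒%≡ (_≡_mod_.x≡y+mk (≡-mod-sym a≡b)))

  %ℕ≡0⇒∣ : ∀ x → x %ℕ m ≡ 0 → + m ∣ x
  %ℕ≡0⇒∣ x x%m≡0 = divides ∣ x /ℕ m ∣ (begin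
    ∣ x ∣                              ≡⟨ cong ∣_∣ (a≡a%ℕn+[a/ℕn]*n x m) ⟩
    ∣ + (x %ℕ m) + x /ℕ m * + m ∣      ≡⟨ cong (λ r → ∣ + r + x /ℕ m * + m ∣) x%m≡0 ⟩
    ∣ 0ℤ + x /ℕ m * + m ∣              ≡⟨ cong ∣_∣ (+-identityˡ (x /ℕ m * + m)) ⟩
    ∣ x /ℕ m * + m ∣                   ≡⟨ abs-* (x /ℕ m) (+ m) ⟩
    ∣ x /ℕ m ∣ ℕ.* m                   ∎)
    where open ≡-Reasoning

  coprime⇒%ℕ≢0 : ∀ x → m ≢ 1 → gcd (+ m) x ≡ 1ℤ → x %ℕ m ≢ 0
  coprime⇒%ℕ≢0 x m≢1 gcd≡1 x%m≡0 =
    m≢1 (∣1⇒≡1 (subst (+ m ∣_) gcd≡1 m∣gcd))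
    where
    m∣gcd : + m ∣ gcd (+ m) x
    m∣gcd = ℤGCD.gcd-greatest {+ m} {x} {+ m} ∣-refl (%ℕ≡0⇒∣ x x%m≡0)

fermat-mod-5 : ∀ {s} → s < 5 → s ≢ 0 → (+ s) ^ 4 ≡ 1ℤ mod 5
fermat-mod-5 {0} _ 0≢0 = ⊥-elim (0≢0 refl)
fermat-mod-5 {1} _ _ = multiple (+ 0) refl
fermat-mod-5 {2} _ _ = multiple (+ 3) refl
fermat-mod-5 {3} _ _ = multiple (+ 16) refl
fermat-mod-5 {4} _ _ = multiple (+ 51) refl
fermat-mod-5 {suc (suc (suc (suc (suc _))))} (s≤s (s≤s (s≤s (s≤s (s≤s ()))))) _

2,3-nonsquares-mod-5 : ∀ {r c} → r < 5 → c ≡ 2 ⊎ c ≡ 3 → r ℕ.^ 2 % 5 ≢ c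
2,3-nonsquares-mod-5 {0} _ (inj₁ refl) ()
2,3-nonsquares-mod-5 {0} _ (inj₂ refl) ()
2,3-nonsquares-mod-5 {1} _ (inj₁ refl) ()
2,3-nonsquares-mod-5 {1} _ (inj₂ refl) ()
2,3-nonsquares-mod-5 {2} _ (inj₁ refl) ()
2,3-nonsquares-mod-5 {2} _ (inj₂ refl) ()
2,3-nonsquares-mod-5 {3} _ (inj₁ refl) ()
2,3-nonsquares-mod-5 {3} _ (inj₂ refl) ()
2,3-nonsquares-mod-5 {4} _ (inj₁ refl) ()
2,3-nonsquares-mod-5 {4} _ (inj₂ refl) ()
2,3-nonsquares-mod-5 {suc (suc (suc (suc (suc _))))} (s≤s (s≤s (s≤s (s≤s (s≤s ()))))) _

pos-^ : ∀ n k → (+ n) ^ k ≡ + (n ℕ.^ k)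
pos-^ n zero    = refl
pos-^ n (suc k) = trans (cong (+ n *_) (pos-^ n k)) (sym (pos-* n (n ℕ.^ k)))

p%40≡7,23⇒p%5≡2,3 : ∀ p → p % 40 ≡ 7 ⊎ p % 40 ≡ 23 → p % 5 ≡ 2 ⊎ p % 5 ≡ 3
p%40≡7,23⇒p%5≡2,3 p = Sum.map (reduce 7) (reduce 23)
  where
  reduce : ∀ r → p % 40 ≡ r → p % 5 ≡ r % 5
  reduce r p%40≡r = trans (sym (m∣n⇒o%n%m≡o%m 5 40 p (divides 8 refl))) (cong (_% 5) p%40≡r)

lemma3p3 : (p : ℕ) → Prime p → (p % 40 ≡ 7 ⊎ p % 40 ≡ 23) →
    ¬ (∃[ N ] ∃[ M ] ∃[ e ]
        (M ≢ 0ℤ × e ≢ 0ℤ ×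
         N ^ 2 ≡ (+ p) * M ^ 4 - (+ 5) * e ^ 4 ×
         gcd N e ≡ 1ℤ × gcd M e ≡ 1ℤ × gcd (+ p) e ≡ 1ℤ ×
         gcd (+ 5) M ≡ 1ℤ × gcd M N ≡ 1ℤ))
lemma3p3 p _ p%40 (N , M , e , _ , _ , equation , _ , _ , _ , gcd[5,M]≡1 , _) =
  2,3-nonsquares-mod-5 (n%ℕd<d N 5) (p%40≡7,23⇒p%5≡2,3 p p%40) (≡-mod⇒%≡ r²≡p)
  where
  open ≡-mod-Reasoning 5
  r : ℕ
  r = N %ℕ 5

  M⁴≡1 : M ^ 4 ≡ 1ℤ mod 5
  M⁴≡1 = begin
    M ^ 4               ≈⟨ ≡-mod-^ 4 (x≡x%ℕm M) ⟩
    (+ (M %ℕ 5)) ^ 4    ≈⟨ fermat-mod-5 (n%ℕd<d M 5) (coprime⇒%ℕ≢0 M (λ ()) gcd[5,M]≡1) ⟩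
    1ℤ                  ∎

  r²≡p : + (r ℕ.^ 2) ≡ + p mod 5
  r²≡p = begin
    + (r ℕ.^ 2)                   ≡⟨ pos-^ r 2 ⟨
    (+ r) ^ 2                     ≈⟨ ≡-mod-^ 2 (x≡x%ℕm N) ⟨
    N ^ 2                         ≡⟨ equation ⟩
    + p * M ^ 4 - + 5 * e ^ 4     ≈⟨ x-m*y≡x (+ p * M ^ 4) (e ^ 4) ⟩
    + p * M ^ 4                   ≈⟨ ≡-mod-* (≡-mod-refl {x = + p}) M⁴≡1 ⟩
    + p * 1ℤ                      ≡⟨ *-identityʳ (+ p) ⟩
    + p                           ∎
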